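{- Let $R$ be a commutative ring and let $(b_1,b_2,\dots)$ and $(c_2,c_3,\dots)$ be sequences in $R$. Let $(a^{(1)}_1,a^{(1)}_2,\dots)$ and $(a^{(2)}_1,a^{(2)}_2,\dots)$ be two sequences in $R$ satisfying the same recurrence \[a^{(i)}_s=b_{s-2}a^{(i)}_{s-2}+c_{s-1}a^{(i)}_{s-1}\qquad (s>2,\ i=1,2).\] Let $r\ge 1$ and $0\le k\le r$ be integers, and define $d_1=1$, $d_2=c_{k+2}$, and $d_i=b_{k+i-1}d_{i-2}+c_{k+i}d_{i-1}$ for $i>2$. Then \[\begin{vmatrix}a^{(1)}_{k+1}&a^{(1)}_{r+2}\\ a^{(2)}_{k+1}&a^{(2)}_{r+2}\end{vmatrix}=(-1)^k\,b_1b_2\cdots b_k\cdot d_{r-k+1}\cdot\begin{vmatrix}a^{(1)}_{1}&a^{(1)}_{2}\\ a^{(2)}_{1}&a^{(2)}_{2}\end{vmatrix},\] where the empty product $b_1\cdots b_0$ equals $1$. -}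

module Defs where

open import Level using (Level)
open import Data.Nat using (ℕ; zero; suc) renaming (_+_ to _+ℕ_)
open import Algebra.Bundles using (CommutativeRing)

module _ {c ℓ : Level} (R : CommutativeRing c ℓ) where
  open CommutativeRing R

  negOnePow : ℕ → Carrier
  negOnePow zero    = 1#
  negOnePow (suc k) = - (negOnePow k)

  prodUpTo : (ℕ → Carrier) → ℕ → Carrier
  prodUpTo b zero    = 1#
  prodUpTo b (suc k) = prodUpTo b k * b (suc k)

  -- d₁ = 1, d₂ = c_{k+2}, d_i = b_{k+i-1} d_{i-2} + c_{k+i} d_{i-1} (i > 2).
  -- Sequences are 1-indexed; the value at index 0 is an unused filler (0#).
  dSeq : (b c : ℕ → Carrier) (k : ℕ) → ℕ → Carrier
  dSeq b c k zero = 0#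
  dSeq b c k (suc zero) = 1#
  dSeq b c k (suc (suc zero)) = c (k +ℕ 2)
  dSeq b c k (suc (suc (suc n))) =
    b (k +ℕ (n +ℕ 2)) * dSeq b c k (suc n) + c (k +ℕ (n +ℕ 3)) * dSeq b c k (suc (suc n))

  det2 : Carrier → Carrier → Carrier → Carrier → Carrier
  det2 x y z w = x * w - y * z

--  * Fixing the first column, the determinant  s ↦ |u_p u_s; v_p v_s|  is a
--    linear combination of u and v, hence again a solution of the recurrence
--    (det2-recurrence).  Its value at s = p is 0 and at s = p+1 it is the
--    Casoratian W_{p-1} = |u_p u_{p+1}; v_p v_{p+1}|.  A solution vanishing at
--    k+1 is determined by its value at k+2 through the sequence d of the
--    paper (solution-vanishing-at), so |u_{k+1} u_{r+2}; …| = d_{r-k+1} W_k.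
--  * Expanding the last column of W_{t+1} by the recurrence and using
--    antisymmetry gives W_{t+1} = -b_{t+1} W_t, hence
--    W_k = (-1)^k b_1⋯b_k W_0 (casoratian-closed-form).
module Submission where

open import Defs
open import Level using (Level)
open import Data.Nat using (ℕ; zero; suc; s≤s; z≤n) renaming (_+_ to _+ℕ_; _∸_ to _∸ℕ_; _<_ to _<ℕ_; _≤_ to _≤ℕ_)
open import Algebra.Bundles using (CommutativeRing)
import Data.Nat.Properties as ℕₚ
open import Relation.Binary.PropositionalEquality using (_≡_; cong; cong₂; module ≡-Reasoning)
  renaming (sym to ≡-sym)
import Algebra.Properties.Ring as RingProperties
import Algebra.Properties.AbelianGroup as AbelianGroupProperties
import Algebra.Properties.CommutativeSemigroup as CommutativeSemigroupProperties
import Algebra.Solver.Ring.NaturalCoefficients.Default as NaturalCoefficientsSolver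
import Relation.Binary.Reasoning.Setoid as SetoidReasoning

+-exchange-ends : ∀ k m j → k +ℕ (m +ℕ j) ≡ j +ℕ (m +ℕ k)
+-exchange-ends k m j = begin
  k +ℕ (m +ℕ j)  ≡⟨ cong (k +ℕ_) (ℕₚ.+-comm m j) ⟩
  k +ℕ (j +ℕ m)  ≡⟨ ℕₚ.+-comm k (j +ℕ m) ⟩
  (j +ℕ m) +ℕ k  ≡⟨ ℕₚ.+-assoc j m k ⟩
  j +ℕ (m +ℕ k)  ∎
  where open ≡-Reasoning

-- The column index r + 2 of the theorem, written as 1 + n + k with
-- n = (r - k) + 1 the index into d.
last-column-index : ∀ r k → k ≤ℕ r → suc (((r ∸ℕ k) +ℕ 1) +ℕ k) ≡ r +ℕ 2
last-column-index r k k≤r = begin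
  suc (((r ∸ℕ k) +ℕ 1) +ℕ k)  ≡⟨ cong suc (ℕₚ.+-assoc (r ∸ℕ k) 1 k) ⟩
  suc ((r ∸ℕ k) +ℕ suc k)     ≡⟨ cong suc (ℕₚ.+-suc (r ∸ℕ k) k) ⟩
  suc (suc ((r ∸ℕ k) +ℕ k))   ≡⟨ cong (λ m → suc (suc m)) (ℕₚ.m∸n+n≡m k≤r) ⟩
  suc (suc r)                 ≡⟨ ℕₚ.+-comm 2 r ⟩
  r +ℕ 2                      ∎
  where open ≡-Reasoning

module Casoratian {c ℓ : Level} (R : CommutativeRing c ℓ) where
  open CommutativeRing R
  open RingProperties ring using (-‿distribˡ-*; -‿distribʳ-*; x[y-z]≈xy-xz)
  open AbelianGroupProperties +-abelianGroup using (⁻¹-∙-comm; ⁻¹-anti-homo‿-)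
  open CommutativeSemigroupProperties +-commutativeSemigroup using (interchange)
  open NaturalCoefficientsSolver commutativeSemiring using (solve; _:=_; _:+_; _:*_)
  open SetoidReasoning setoid

  det2-equal-columns : ∀ x z → det2 R x x z z ≈ 0#
  det2-equal-columns x z = -‿inverseʳ (x * z)

  det2-swap : ∀ x y z w → det2 R y x w z ≈ - det2 R x y z w
  det2-swap x y z w = sym (⁻¹-anti-homo‿- (x * w) (y * z))

  det2-additiveʳ : ∀ x z y y′ w w′ →
    det2 R x (y + y′) z (w + w′) ≈ det2 R x y z w + det2 R x y′ z w′
  det2-additiveʳ x z y y′ w w′ = begin
    x * (w + w′) - (y + y′) * z
      ≈⟨ +-cong (distribˡ x w w′) (-‿cong (distribʳ z y y′)) ⟩
    (x * w + x * w′) - (y * z + y′ * z)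
      ≈⟨ +-congˡ (sym (⁻¹-∙-comm (y * z) (y′ * z))) ⟩
    (x * w + x * w′) + (- (y * z) + - (y′ * z))
      ≈⟨ interchange (x * w) (x * w′) (- (y * z)) (- (y′ * z)) ⟩
    (x * w - y * z) + (x * w′ - y′ * z) ∎

  det2-homogeneousʳ : ∀ β x y z w → det2 R x (β * y) z (β * w) ≈ β * det2 R x y z w
  det2-homogeneousʳ β x y z w = begin
    x * (β * w) - (β * y) * z  ≈⟨ +-cong (solve 3 (λ x β w → x :* (β :* w) := β :* (x :* w)) refl x β w)
                                         (-‿cong (*-assoc β y z)) ⟩
    β * (x * w) - β * (y * z)  ≈⟨ sym (x[y-z]≈xy-xz β (x * w) (y * z)) ⟩
    β * (x * w - y * z)        ∎

  Recurrence : (b cc u : ℕ → Carrier) → Set ℓ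
  Recurrence b cc u = ∀ s → 2 <ℕ s → u s ≈ b (s ∸ℕ 2) * u (s ∸ℕ 2) + cc (s ∸ℕ 1) * u (s ∸ℕ 1)

  module _ (b cc : ℕ → Carrier) where

    -- The recurrence at s = t + 3, where the subtractions compute.
    recurrence-step : ∀ {u} → Recurrence b cc u →
      ∀ t → u (suc (suc (suc t))) ≈ b (suc t) * u (suc t) + cc (suc (suc t)) * u (suc (suc t))
    recurrence-step rec t = rec (suc (suc (suc t))) (s≤s (s≤s (s≤s z≤n)))

    det2-recurrence : ∀ {u v} → Recurrence b cc u → Recurrence b cc v →
      ∀ x y → Recurrence b cc (λ s → det2 R x (u s) y (v s))
    det2-recurrence {u} {v} recᵤ recᵥ x y s 2<s = begin
      det2 R x (u s) y (v s)
        ≈⟨ +-cong (*-congˡ (recᵥ s 2<s)) (-‿cong (*-congʳ (recᵤ s 2<s))) ⟩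
      det2 R x (β * u (s ∸ℕ 2) + γ * u (s ∸ℕ 1)) y (β * v (s ∸ℕ 2) + γ * v (s ∸ℕ 1))
        ≈⟨ det2-additiveʳ x y _ _ _ _ ⟩
      det2 R x (β * u (s ∸ℕ 2)) y (β * v (s ∸ℕ 2)) + det2 R x (γ * u (s ∸ℕ 1)) y (γ * v (s ∸ℕ 1))
        ≈⟨ +-cong (det2-homogeneousʳ β x _ y _) (det2-homogeneousʳ γ x _ y _) ⟩
      β * det2 R x (u (s ∸ℕ 2)) y (v (s ∸ℕ 2)) + γ * det2 R x (u (s ∸ℕ 1)) y (v (s ∸ℕ 1)) ∎
      where
        β = b (s ∸ℕ 2)
        γ = cc (s ∸ℕ 1)

    -- d := dSeq R b cc k, shifted by k, obeys the same recurrence for all n,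
    -- the filler d₀ = 0 included.
    dSeq-step : ∀ k n → dSeq R b cc k (suc (suc n))
      ≈ b (suc (n +ℕ k)) * dSeq R b cc k n + cc (suc (suc (n +ℕ k))) * dSeq R b cc k (suc n)
    dSeq-step k zero = begin
      cc (k +ℕ 2)                          ≡⟨ cong cc (+-exchange-ends k 0 2) ⟩
      cc (suc (suc k))                     ≈⟨ sym (*-identityʳ _) ⟩
      cc (suc (suc k)) * 1#                ≈⟨ sym (+-identityˡ _) ⟩
      0# + cc (suc (suc k)) * 1#           ≈⟨ +-congʳ (sym (zeroʳ (b (suc k)))) ⟩
      b (suc k) * 0# + cc (suc (suc k)) * 1# ∎
    dSeq-step k (suc m) = +-cong (*-congʳ (reflexive (cong b (+-exchange-ends k m 2))))
                                 (*-congʳ (reflexive (cong cc (+-exchange-ends k m 3))))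

    solution-vanishing-at : ∀ {u} → Recurrence b cc u → ∀ k → u (suc k) ≈ 0# →
      ∀ n → u (suc (n +ℕ k)) ≈ dSeq R b cc k n * u (suc (suc k))
    solution-vanishing-at rec k u₀≈0 zero          = trans u₀≈0 (sym (zeroˡ _))
    solution-vanishing-at rec k u₀≈0 (suc zero)    = sym (*-identityˡ _)
    solution-vanishing-at {u} rec k u₀≈0 (suc (suc m)) = begin
      u (suc (suc (suc (m +ℕ k))))
        ≈⟨ recurrence-step rec (m +ℕ k) ⟩
      β * u (suc (m +ℕ k)) + γ * u (suc (suc (m +ℕ k)))
        ≈⟨ +-cong (*-congˡ (solution-vanishing-at rec k u₀≈0 m))
                  (*-congˡ (solution-vanishing-at rec k u₀≈0 (suc m))) ⟩
      β * (d m * E) + γ * (d (suc m) * E)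
        ≈⟨ solve 5 (λ β γ x y E → β :* (x :* E) :+ γ :* (y :* E) := (β :* x :+ γ :* y) :* E)
                 refl β γ (d m) (d (suc m)) E ⟩
      (β * d m + γ * d (suc m)) * E
        ≈⟨ *-congʳ (sym (dSeq-step k m)) ⟩
      d (suc (suc m)) * E ∎
      where
        β = b (suc (m +ℕ k))
        γ = cc (suc (suc (m +ℕ k)))
        d = dSeq R b cc k
        E = u (suc (suc k))

    module _ (u v : ℕ → Carrier) where

      column : ℕ → ℕ → Carrier
      column p s = det2 R (u p) (u s) (v p) (v s)

      W : ℕ → Carrier
      W t = column (suc t) (suc (suc t))

      module _ (recᵤ : Recurrence b cc u) (recᵥ : Recurrence b cc v) where

        casoratian-step : ∀ t → W (suc t) ≈ - (b (suc t) * W t)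
        casoratian-step t = begin
          column p (suc p)
            ≈⟨ recurrence-step (det2-recurrence recᵤ recᵥ (u p) (v p)) t ⟩
          b (suc t) * column p (suc t) + cc p * column p p
            ≈⟨ +-cong (*-congˡ (det2-swap _ _ _ _)) (*-congˡ (det2-equal-columns _ _)) ⟩
          b (suc t) * (- W t) + cc p * 0#
            ≈⟨ trans (+-congˡ (zeroʳ _)) (+-identityʳ _) ⟩
          b (suc t) * (- W t)
            ≈⟨ sym (-‿distribʳ-* _ _) ⟩
          - (b (suc t) * W t) ∎
          where p = suc (suc t)

        casoratian-closed-form : ∀ k → W k ≈ negOnePow R k * prodUpTo R b k * W 0
        casoratian-closed-form zero = sym (trans (*-congʳ (*-identityˡ 1#)) (*-identityˡ _))
        casoratian-closed-form (suc k) = begin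
          W (suc k)                    ≈⟨ casoratian-step k ⟩
          - (β * W k)                  ≈⟨ -‿cong (*-congˡ (casoratian-closed-form k)) ⟩
          - (β * (N * P * W 0))        ≈⟨ -‿cong (solve 4 (λ β N P E → β :* (N :* P :* E) := N :* (P :* β) :* E)
                                                    refl β N P (W 0)) ⟩
          - (N * (P * β) * W 0)        ≈⟨ -‿distribˡ-* _ _ ⟩
          - (N * (P * β)) * W 0        ≈⟨ *-congʳ (-‿distribˡ-* N _) ⟩
          - N * (P * β) * W 0          ∎
          where
            β = b (suc k)
            N = negOnePow R k
            P = prodUpTo R b k

        column-from-casoratian : ∀ k n → column (suc k) (suc (n +ℕ k)) ≈ dSeq R b cc k n * W k
        column-from-casoratian k =
          solution-vanishing-at (det2-recurrence recᵤ recᵥ (u (suc k)) (v (suc k))) k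
            (det2-equal-columns _ _)

mainTheorem2 : ∀ {c ℓ : Level} (R : CommutativeRing c ℓ) →
    let open CommutativeRing R in
    (b cc a₁ a₂ : ℕ → Carrier) →
    (∀ s → 2 <ℕ s → a₁ s ≈ b (s ∸ℕ 2) * a₁ (s ∸ℕ 2) + cc (s ∸ℕ 1) * a₁ (s ∸ℕ 1)) →
    (∀ s → 2 <ℕ s → a₂ s ≈ b (s ∸ℕ 2) * a₂ (s ∸ℕ 2) + cc (s ∸ℕ 1) * a₂ (s ∸ℕ 1)) →
    (r k : ℕ) → 1 ≤ℕ r → k ≤ℕ r →
    det2 R (a₁ (k +ℕ 1)) (a₁ (r +ℕ 2)) (a₂ (k +ℕ 1)) (a₂ (r +ℕ 2))
    ≈ negOnePow R k * prodUpTo R b k * dSeq R b cc k ((r ∸ℕ k) +ℕ 1)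
    * det2 R (a₁ 1) (a₁ 2) (a₂ 1) (a₂ 2)
mainTheorem2 R b cc a₁ a₂ rec₁ rec₂ r k _ k≤r = begin
  det2 R (a₁ (k +ℕ 1)) (a₁ (r +ℕ 2)) (a₂ (k +ℕ 1)) (a₂ (r +ℕ 2))
    ≡⟨ cong₂ D (ℕₚ.+-comm k 1) (≡-sym (last-column-index r k k≤r)) ⟩
  D (suc k) (suc (n +ℕ k))   ≈⟨ column-from-casoratian b cc a₁ a₂ rec₁ rec₂ k n ⟩
  d * W₍ k ₎                 ≈⟨ *-congˡ (casoratian-closed-form b cc a₁ a₂ rec₁ rec₂ k) ⟩
  d * (N * P * W₍ 0 ₎)       ≈⟨ solve 4 (λ d N P E → d :* (N :* P :* E) := N :* P :* d :* E) refl d N P W₍ 0 ₎ ⟩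
  N * P * d * W₍ 0 ₎         ∎
  where
    open CommutativeRing R
    open Casoratian R
    open NaturalCoefficientsSolver commutativeSemiring using (solve; _:=_; _:*_)
    open SetoidReasoning setoid
    D = column b cc a₁ a₂
    W₍_₎ = W b cc a₁ a₂
    n = (r ∸ℕ k) +ℕ 1
    d = dSeq R b cc k n
    N = negOnePow R k
    P = prodUpTo R b k
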